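{- Let $\mathbf{d}=(d_1,d_2,n-1,\dots,n-1,n,\dots,n)$ be a Dyck path on an $n\times n$ board with bounce number $|\mathbf{m}|=3$, $\mathbf{m}=(m_0,m_1,n)$, and let $P=P(\mathbf{d})$. Then: (a) If $S_3\neq\{n\}$, then $m_0=1$. (b) Let $T$ be any $P$-tableau of shape $3^12^11^{n-5}$, with $a_{i,j}$ its entry in row $i$, column $j$. If $a_{1,3}=n$, then $a_{1,1},a_{2,1}\in\{1,2\}$. If $a_{1,3}\neq n$, then $S_1=\{1\}$, $a_{1,1}=1$, $a_{1,2}=2$ and $a_{2,2}=n$. (c) Let $T$ be any $P$-tableau. If $T$ has a row of length $3$, then $T$ has at most one row of length $3$ and at most one row of length $2$. If all rows of $T$ have length at most $2$, then $T$ has at most three rows of length $2$.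
   Context: A Dyck path on an $n\times n$ board is a sequence $\mathbf{d}=(d_1,\dots,d_{n-1})$ of positive integers with $d_1\le\cdots\le d_{n-1}\le n$ and $d_i\ge i$; here $d_i\in\{n-1,n\}$ for $i\ge 3$. The poset $P(\mathbf{d})$ on $[n]$ has relations $i\prec j$ iff $i<n$ and $d_i<j\le n$. The bounce sequence is $m_0=d_1$, $m_i=d_{m_{i-1}+1}$, stopping at $n$; bounce number $3$ means $\mathbf{m}=(m_0,m_1,n)$. Set $S_1=\{1,\dots,m_0\}$, $S_2=\{m_0+1,\dots,m_1\}$, $S_3=\{m_1+1,\dots,n\}$. A $P$-tableau of shape $\lambda$ is a filling of the Young diagram of $\lambda$ (English convention) with each element of $P$ exactly once such that $a_{i,j}\prec a_{i,j+1}$ and $a_{i+1,j}\not\prec a_{i,j}$ for all $i,j$; $3^12^11^{n-5}$ is the partition $(3,2,1,\dots,1)$ of $n$. (Each row of a $P$-tableau is a chain in $P$.) -}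

module Defs where

open import Data.Nat using (ℕ; zero; suc; _+_; _∸_; _≤_; _<_; _≥_; _<?_; _≟_)
open import Data.Nat.Properties using ()
open import Data.Bool using (if_then_else_)
open import Data.List using (List; []; _∷_; map; length; upTo; concat; zip; filter)
open import Data.List.Relation.Unary.All using (All)
open import Data.List.Relation.Unary.Linked using (Linked)
open import Data.List.Relation.Binary.Permutation.Propositional using (_↭_)
open import Data.Product using (_×_; proj₁; proj₂)
open import Data.Sum using (_⊎_)
open import Relation.Nullary using (¬_)
open import Relation.Nullary.Decidable using (⌊_⌋)
open import Relation.Binary.PropositionalEquality using (_≡_)

interval : ℕ → ℕ → List ℕ
interval a b = map (a +_) (upTo (suc b ∸ a))

-- A Dyck path d = (d_1, ..., d_{n-1}) is represented by a function d : ℕ → ℕ,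
-- of which only the values d 1, ..., d (n-1) are used.
record IsDyckPath (n : ℕ) (d : ℕ → ℕ) : Set where
  field
    bounded   : ∀ i → 1 ≤ i → i < n → i ≤ d i × d i ≤ n
    monotone  : ∀ i → 1 ≤ i → suc i < n → d i ≤ d (suc i)

SpecialForm : ℕ → (ℕ → ℕ) → Set
SpecialForm n d = ∀ i → 3 ≤ i → i < n → d i ≡ n ∸ 1 ⊎ d i ≡ n

-- d extended by the convention d_n = n (needed when a bounce lands at n-1).
dExt : ℕ → (ℕ → ℕ) → ℕ → ℕ
dExt n d i = if ⌊ i <? n ⌋ then d i else n

bounce : ℕ → (ℕ → ℕ) → ℕ → ℕ
bounce n d zero    = dExt n d 1
bounce n d (suc k) = dExt n d (suc (bounce n d k))

BounceNumber3 : ℕ → (ℕ → ℕ) → Set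
BounceNumber3 n d = bounce n d 0 < n × bounce n d 1 < n × bounce n d 2 ≡ n

m₀ m₁ : ℕ → (ℕ → ℕ) → ℕ
m₀ n d = bounce n d 0
m₁ n d = bounce n d 1

S₁ S₂ S₃ : ℕ → (ℕ → ℕ) → List ℕ
S₁ n d = interval 1 (m₀ n d)
S₂ n d = interval (suc (m₀ n d)) (m₁ n d)
S₃ n d = interval (suc (m₁ n d)) n

_≺[_,_]_ : ℕ → ℕ → (ℕ → ℕ) → ℕ → Set
i ≺[ n , d ] j = i < n × d i < j × j ≤ n

ColumnOK : ℕ → (ℕ → ℕ) → List ℕ → List ℕ → Set
ColumnOK n d r r' = All (λ p → ¬ (proj₂ p ≺[ n , d ] proj₁ p)) (zip r r')

shape : List (List ℕ) → List ℕ
shape T = map length T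

record IsPTableau (n : ℕ) (d : ℕ → ℕ) (T : List (List ℕ)) : Set where
  field
    partitionShape : Linked _≥_ (shape T)
    nonemptyRows   : All (λ r → 1 ≤ length r) T
    bijective      : concat T ↭ interval 1 n
    rowsChains     : All (Linked (λ x y → x ≺[ n , d ] y)) T
    columns        : Linked (ColumnOK n d) T

multiplicity : ℕ → List ℕ → ℕ
multiplicity k λs = length (filter (_≟ k) λs)

shape321 : ℕ → List ℕ
shape321 n = 3 ∷ 2 ∷ Data.List.replicate (n ∸ 5) 1

-- For i ≥ 3 we have d_i ≥ n - 1, so an element i ≥ 3 can only lie below n.
-- Hence in every relation x ≺ y one has x ∈ {1, 2} or y = n: a row of length 2
-- meets K = {1, 2, n}, and a row x ≺ y ≺ z has x ∈ {1, 2} (as y < n) and y ∈ K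
-- or z = n, so it meets K twice. The rows are disjoint, so
-- #(rows of length 2) + 2 · #(rows of length 3) ≤ |K| = 3, which is (c).
-- Part (b) is the same local analysis of the first two rows, and part (a)
-- holds because m₀ ≥ 2 forces m₁ = d_{m₀+1} = n - 1.
module Submission where

open import Defs
open import Data.Nat using (ℕ; suc; _+_; _*_; _∸_; _≤_; _<_; z≤n; s≤s; _≟_; _<?_; >-nonZero)
open import Data.Nat.Properties
  using (≤-refl; ≤-trans; ≤-antisym; ≤-pred; <-irrefl; <⇒≢; ≤⇒≯; ≮⇒≥; m≤m+n; m≤n+m; m≤n+m∸n; m+n∸n≡m;
         suc-pred; suc-injective; +-identityʳ; +-suc; *-suc; +-mono-≤; +-cancelʳ-≤; *-monoʳ-≤; module ≤-Reasoning)
open import Data.List using (List; []; _∷_; map; length; upTo; concat; filter; _++_)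
open import Data.Nat.ListAction using (sum)
open import Data.List.Properties using (length-++; filter-++; filter-accept; filter-some; map-∘; length-removeAt′)
open import Data.List.Membership.Propositional using (_∈_)
open import Data.List.Membership.DecPropositional _≟_ using (_∈?_)
open import Data.List.Relation.Unary.All using (All; []; _∷_; universal)
import Data.List.Relation.Unary.All as All
open import Data.List.Relation.Unary.All.Properties using (all-filter; concat⁻)
import Data.List.Relation.Unary.All.Properties as All
open import Data.List.Relation.Unary.Any using (Any; here; there; _─_; index)
import Data.List.Relation.Unary.Any as Any
open import Data.List.Relation.Unary.AllPairs using ([]; _∷_)
open import Data.List.Relation.Unary.Linked using (Linked; []; [-]; _∷_)
open import Data.List.Relation.Unary.Unique.Propositional using (Unique)
import Data.List.Relation.Unary.Unique.Propositional.Properties as Unique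
open import Data.List.Relation.Binary.Permutation.Propositional using (↭-sym; ↭⇒↭ₛ)
open import Data.List.Relation.Binary.Permutation.Propositional.Properties using (All-resp-↭)
import Data.List.Relation.Binary.Permutation.Setoid.Properties as PermutationSetoid
open import Data.Product using (_×_; _,_; proj₁; proj₂)
open import Data.Sum using (_⊎_; inj₁; inj₂; [_,_]′)
open import Function using (_∘_; id)
open import Relation.Nullary using (¬_; Dec; yes; no; contradiction)
open import Relation.Binary.PropositionalEquality
  using (_≡_; _≢_; refl; sym; trans; cong; subst; subst₂; setoid; module ≡-Reasoning)

∈-─⁺ : ∀ {A : Set} {x y : A} {ys} (p : y ∈ ys) → x ∈ ys → x ≢ y → x ∈ (ys ─ p)
∈-─⁺ (here refl) (here refl) x≢y = contradiction refl x≢y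
∈-─⁺ (here refl) (there q)   _   = q
∈-─⁺ (there p)   (here refl) _   = here refl
∈-─⁺ (there p)   (there q)   x≢y = there (∈-─⁺ p q x≢y)

unique⊆⇒length≤ : ∀ {A : Set} {xs ys : List A} → Unique xs → All (_∈ ys) xs → length xs ≤ length ys
unique⊆⇒length≤ [] [] = z≤n
unique⊆⇒length≤ {ys = ys} (x≢xs ∷ u) (x∈ys ∷ xs⊆ys) =
  subst (_ ≤_) (sym (length-removeAt′ ys (index x∈ys)))
    (s≤s (unique⊆⇒length≤ u (All.zipWith (λ (x≢z , z∈ys) → ∈-─⁺ x∈ys z∈ys (x≢z ∘ sym)) (x≢xs , xs⊆ys))))

sum-map-mono-≤ : ∀ {A : Set} {f g : A → ℕ} {xs} → All (λ x → f x ≤ g x) xs → sum (map f xs) ≤ sum (map g xs)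
sum-map-mono-≤ []           = z≤n
sum-map-mono-≤ (fx≤gx ∷ ps) = +-mono-≤ fx≤gx (sum-map-mono-≤ ps)

sum-length-filter : ∀ {A : Set} {P : A → Set} (P? : ∀ x → Dec (P x)) (xss : List (List A)) →
  sum (map (length ∘ filter P?) xss) ≡ length (filter P? (concat xss))
sum-length-filter P? []         = refl
sum-length-filter P? (xs ∷ xss) = begin
  length (filter P? xs) + sum (map (length ∘ filter P?) xss)  ≡⟨ cong (length (filter P? xs) +_) (sum-length-filter P? xss) ⟩
  length (filter P? xs) + length (filter P? (concat xss))     ≡⟨ sym (length-++ (filter P? xs)) ⟩
  length (filter P? xs ++ filter P? (concat xss))             ≡⟨ cong length (sym (filter-++ P? xs (concat xss))) ⟩
  length (filter P? (xs ++ concat xss))                       ∎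
  where open ≡-Reasoning

-- How many of 1, 2, n a row of the given length is forced to contain.
charge : ℕ → ℕ
charge 2 = 1
charge 3 = 2
charge _ = 0

multiplicity-charge : ∀ ls → multiplicity 2 ls + 2 * multiplicity 3 ls ≡ sum (map charge ls)
multiplicity-charge []                              = refl
multiplicity-charge (0 ∷ ls)                        = multiplicity-charge ls
multiplicity-charge (1 ∷ ls)                        = multiplicity-charge ls
multiplicity-charge (2 ∷ ls)                        = cong suc (multiplicity-charge ls)
multiplicity-charge (3 ∷ ls)                        = begin
  μ₂ + 2 * suc μ₃        ≡⟨ cong (μ₂ +_) (*-suc 2 μ₃) ⟩
  μ₂ + suc (suc (2 * μ₃)) ≡⟨ +-suc μ₂ (suc (2 * μ₃)) ⟩
  suc (μ₂ + suc (2 * μ₃)) ≡⟨ cong suc (+-suc μ₂ (2 * μ₃)) ⟩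
  2 + (μ₂ + 2 * μ₃)       ≡⟨ cong (2 +_) (multiplicity-charge ls) ⟩
  2 + sum (map charge ls) ∎
  where
  open ≡-Reasoning
  μ₂ = multiplicity 2 ls
  μ₃ = multiplicity 3 ls
multiplicity-charge (suc (suc (suc (suc _))) ∷ ls) = multiplicity-charge ls

∈⇒1≤multiplicity : ∀ {k ls} → k ∈ ls → 1 ≤ multiplicity k ls
∈⇒1≤multiplicity {k} = filter-some (_≟ k) ∘ Any.map sym

m+2n≤3⇒n≤1×m≤1 : ∀ m n → m + 2 * n ≤ 3 → 1 ≤ n → n ≤ 1 × m ≤ 1
m+2n≤3⇒n≤1×m≤1 m 1               m+2≤3 _ = ≤-refl , +-cancelʳ-≤ 2 m 1 m+2≤3
m+2n≤3⇒n≤1×m≤1 m n@(suc (suc _)) m+2n≤3 _ = contradiction 4≤3 λ { (s≤s (s≤s (s≤s ()))) }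
  where
  4≤3 : 4 ≤ 3
  4≤3 = ≤-trans (*-monoʳ-≤ 2 (s≤s (s≤s z≤n))) (≤-trans (m≤n+m (2 * n) m) m+2n≤3)

interval-singleton : ∀ m → interval m m ≡ m ∷ []
interval-singleton m = begin
  map (m +_) (upTo (suc m ∸ m)) ≡⟨ cong (map (m +_) ∘ upTo) (m+n∸n≡m 1 m) ⟩
  m + 0 ∷ []                    ≡⟨ cong (_∷ []) (+-identityʳ m) ⟩
  m ∷ []                        ∎
  where open ≡-Reasoning

module _ {n : ℕ} {d : ℕ → ℕ} where

  dExt≡d : ∀ {i} → i < n → dExt n d i ≡ d i
  dExt≡d {i} i<n with i <? n
  ... | yes _   = refl
  ... | no i≮n = contradiction i<n i≮n

  dExt<n⇒<n : ∀ {i} → dExt n d i < n → i < n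
  dExt<n⇒<n {i} dExt<n with i <? n
  ... | yes i<n = i<n
  ... | no _    = contradiction dExt<n (<-irrefl refl)

  module _ {T : List (List ℕ)} (tab : IsPTableau n d T) where
    open IsPTableau tab

    entries-positive : All (All (1 ≤_)) T
    entries-positive = concat⁻ (All-resp-↭ (↭-sym bijective) (All.map⁺ (universal (λ _ → s≤s z≤n) (upTo n))))

    entries-unique : Unique (concat T)
    entries-unique = PermutationSetoid.Unique-resp-↭ (setoid ℕ) (↭⇒↭ₛ (↭-sym bijective))
                       (Unique.map⁺ suc-injective (Unique.upTo⁺ n))

Low : ℕ → Set
Low x = x ≡ 1 ⊎ x ≡ 2

low-above-positive : ∀ {x y} → 1 ≤ x → x < y → Low y → x ≡ 1 × y ≡ 2
low-above-positive (s≤s z≤n)       (s≤s ())       (inj₁ refl)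
low-above-positive {1}            _ _              (inj₂ refl) = refl , refl
low-above-positive {suc (suc _)}  _ (s≤s (s≤s ())) (inj₂ refl)

module SpecialDyckPath {n : ℕ} {d : ℕ → ℕ} (dyck : IsDyckPath n d) (special : SpecialForm n d) where
  open IsDyckPath dyck

  _≺_ : ℕ → ℕ → Set
  x ≺ y = x ≺[ n , d ] y

  ≺⇒< : ∀ {x y} → 1 ≤ x → x ≺ y → x < y
  ≺⇒< 1≤x (x<n , dx<y , _) = ≤-trans (s≤s (proj₁ (bounded _ 1≤x x<n))) dx<y

  ≺-low-or-top : ∀ {x y} → 1 ≤ x → x ≺ y → Low x ⊎ y ≡ n
  ≺-low-or-top {1} _ _ = inj₁ (inj₁ refl)
  ≺-low-or-top {2} _ _ = inj₁ (inj₂ refl)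
  ≺-low-or-top {x@(suc (suc (suc _)))} _ (x<n , dx<y , y≤n) with special x (s≤s (s≤s (s≤s z≤n))) x<n
  ... | inj₁ dx≡n∸1 = inj₂ (≤-antisym y≤n (≤-trans (m≤n+m∸n n 1) (subst (_< _) dx≡n∸1 dx<y)))
  ... | inj₂ dx≡n   = contradiction (subst (_< _) dx≡n dx<y) (≤⇒≯ y≤n)

  ≺-low-unless-top : ∀ {x y} → 1 ≤ x → x ≺ y → y ≢ n → Low x
  ≺-low-unless-top 1≤x x≺y y≢n = [ id , (λ y≡n → contradiction y≡n y≢n) ]′ (≺-low-or-top 1≤x x≺y)

  1≺2⇒S₁≡[1] : 1 ≺ 2 → S₁ n d ≡ 1 ∷ []
  1≺2⇒S₁≡[1] (1<n , d₁<2 , _) =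
    cong (interval 1) (trans (dExt≡d {d = d} 1<n) (≤-antisym (≤-pred d₁<2) (proj₁ (bounded 1 ≤-refl 1<n))))

  m₀≥2⇒m₁≡n∸1 : m₁ n d < n → 2 ≤ m₀ n d → m₁ n d ≡ n ∸ 1
  m₀≥2⇒m₁≡n∸1 m₁<n 2≤m₀ =
    [ trans m₁≡dₘ₀₊₁ , (λ dₘ₀₊₁≡n → contradiction (trans m₁≡dₘ₀₊₁ dₘ₀₊₁≡n) (<⇒≢ m₁<n)) ]′
      (special (suc (m₀ n d)) (s≤s 2≤m₀) m₀+1<n)
    where
    m₀+1<n : suc (m₀ n d) < n
    m₀+1<n = dExt<n⇒<n {d = d} m₁<n
    m₁≡dₘ₀₊₁ : m₁ n d ≡ d (suc (m₀ n d))
    m₁≡dₘ₀₊₁ = dExt≡d {d = d} m₀+1<n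

  m₀≥2⇒S₃≡[n] : BounceNumber3 n d → 2 ≤ m₀ n d → S₃ n d ≡ n ∷ []
  m₀≥2⇒S₃≡[n] (_ , m₁<n , _) 2≤m₀ = begin
    interval (suc (m₁ n d)) n ≡⟨ cong (λ m → interval (suc m) n) (m₀≥2⇒m₁≡n∸1 m₁<n 2≤m₀) ⟩
    interval (suc (n ∸ 1)) n  ≡⟨ cong (λ m → interval m n) (suc-pred n {{>-nonZero (≤-trans (s≤s z≤n) m₁<n)}}) ⟩
    interval n n              ≡⟨ interval-singleton n ⟩
    n ∷ []                    ∎
    where open ≡-Reasoning

  m₀≡1 : BounceNumber3 n d → S₃ n d ≢ n ∷ [] → m₀ n d ≡ 1
  m₀≡1 b3@(m₀<n , _) S₃≢[n] = ≤-antisym (≮⇒≥ (S₃≢[n] ∘ m₀≥2⇒S₃≡[n] b3)) 1≤m₀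
    where
    1<n : 1 < n
    1<n = dExt<n⇒<n {d = d} m₀<n
    1≤m₀ : 1 ≤ m₀ n d
    1≤m₀ = subst (1 ≤_) (sym (dExt≡d {d = d} 1<n)) (proj₁ (bounded 1 ≤-refl 1<n))

  first-two-rows : ∀ a₁₁ a₁₂ a₁₃ a₂₁ a₂₂ rest →
    IsPTableau n d ((a₁₁ ∷ a₁₂ ∷ a₁₃ ∷ []) ∷ (a₂₁ ∷ a₂₂ ∷ []) ∷ rest) →
    (a₁₃ ≡ n → Low a₁₁ × Low a₂₁) × (a₁₃ ≢ n → S₁ n d ≡ 1 ∷ [] × a₁₁ ≡ 1 × a₁₂ ≡ 2 × a₂₂ ≡ n)
  first-two-rows a₁₁ a₁₂ a₁₃ a₂₁ a₂₂ rest tab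
    with entries-positive tab | entries-unique tab | IsPTableau.rowsChains tab
  ... | (1≤a₁₁ ∷ 1≤a₁₂ ∷ _) ∷ (1≤a₂₁ ∷ _) ∷ _
      | (_ ∷ _ ∷ a₁₁≢a₂₁ ∷ _) ∷ (_ ∷ a₁₂≢a₂₁ ∷ _) ∷ (_ ∷ a₁₃≢a₂₂ ∷ _) ∷ _
      | (a₁₁≺a₁₂ ∷ a₁₂≺a₁₃ ∷ [-]) ∷ (a₂₁≺a₂₂ ∷ [-]) ∷ _
      = a₁₃-top , a₁₃-not-top
    where
    a₁₃-top : a₁₃ ≡ n → Low a₁₁ × Low a₂₁
    a₁₃-top a₁₃≡n =
        ≺-low-unless-top 1≤a₁₁ a₁₁≺a₁₂ (<⇒≢ (proj₁ a₁₂≺a₁₃))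
      , ≺-low-unless-top 1≤a₂₁ a₂₁≺a₂₂ (λ a₂₂≡n → a₁₃≢a₂₂ (trans a₁₃≡n (sym a₂₂≡n)))

    a₁₃-not-top : a₁₃ ≢ n → S₁ n d ≡ 1 ∷ [] × a₁₁ ≡ 1 × a₁₂ ≡ 2 × a₂₂ ≡ n
    a₁₃-not-top a₁₃≢n = 1≺2⇒S₁≡[1] (subst₂ _≺_ a₁₁≡1 a₁₂≡2 a₁₁≺a₁₂) , a₁₁≡1 , a₁₂≡2 , a₂₂≡n
      where
      a₁₁≡1×a₁₂≡2 : a₁₁ ≡ 1 × a₁₂ ≡ 2
      a₁₁≡1×a₁₂≡2 = low-above-positive 1≤a₁₁ (≺⇒< 1≤a₁₁ a₁₁≺a₁₂) (≺-low-unless-top 1≤a₁₂ a₁₂≺a₁₃ a₁₃≢n)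
      a₁₁≡1 : a₁₁ ≡ 1
      a₁₁≡1 = proj₁ a₁₁≡1×a₁₂≡2
      a₁₂≡2 : a₁₂ ≡ 2
      a₁₂≡2 = proj₂ a₁₁≡1×a₁₂≡2
      a₂₁-not-low : ¬ Low a₂₁
      a₂₁-not-low (inj₁ a₂₁≡1) = a₁₁≢a₂₁ (trans a₁₁≡1 (sym a₂₁≡1))
      a₂₁-not-low (inj₂ a₂₁≡2) = a₁₂≢a₂₁ (trans a₁₂≡2 (sym a₂₁≡2))
      a₂₂≡n : a₂₂ ≡ n
      a₂₂≡n = [ (λ low → contradiction low a₂₁-not-low) , id ]′ (≺-low-or-top 1≤a₂₁ a₂₁≺a₂₂)

  K : List ℕ
  K = 1 ∷ 2 ∷ n ∷ []

  low⇒∈K : ∀ {x} → Low x → x ∈ K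
  low⇒∈K (inj₁ x≡1) = here x≡1
  low⇒∈K (inj₂ x≡2) = there (here x≡2)

  ≺-meets-K : ∀ {x y} → 1 ≤ x → x ≺ y → Any (_∈ K) (x ∷ y ∷ [])
  ≺-meets-K 1≤x x≺y =
    [ here ∘ low⇒∈K , (λ y≡n → there (here (there (there (here y≡n))))) ]′ (≺-low-or-top 1≤x x≺y)

  K-weight : List ℕ → ℕ
  K-weight r = length (filter (_∈? K) r)

  charge≤K-weight : ∀ {r} → All (1 ≤_) r → Linked _≺_ r → charge (length r) ≤ K-weight r
  charge≤K-weight {[]}     _ _ = z≤n
  charge≤K-weight {_ ∷ []} _ _ = z≤n
  charge≤K-weight {_ ∷ _ ∷ []} (1≤x ∷ _) (x≺y ∷ [-]) = filter-some (_∈? K) (≺-meets-K 1≤x x≺y)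
  charge≤K-weight {x ∷ _ ∷ _ ∷ []} (1≤x ∷ 1≤y ∷ _) (x≺y ∷ y≺z ∷ [-]) =
    subst (2 ≤_) (cong length (sym (filter-accept (_∈? K) x∈K))) (s≤s (filter-some (_∈? K) (≺-meets-K 1≤y y≺z)))
    where
    x∈K : x ∈ K
    x∈K = low⇒∈K (≺-low-unless-top 1≤x x≺y (<⇒≢ (proj₁ y≺z)))
  charge≤K-weight {_ ∷ _ ∷ _ ∷ _ ∷ _} _ _ = z≤n

  tableau-charge≤3 : ∀ {T} → IsPTableau n d T → multiplicity 2 (shape T) + 2 * multiplicity 3 (shape T) ≤ 3
  tableau-charge≤3 {T} tab = begin
    multiplicity 2 (shape T) + 2 * multiplicity 3 (shape T) ≡⟨ multiplicity-charge (shape T) ⟩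
    sum (map charge (map length T))                          ≡⟨ cong sum (map-∘ T) ⟨
    sum (map (charge ∘ length) T)                            ≤⟨ sum-map-mono-≤ (All.zipWith (λ (p , c) → charge≤K-weight p c)
                                                                                   (entries-positive tab , IsPTableau.rowsChains tab)) ⟩
    sum (map K-weight T)                                     ≡⟨ sum-length-filter (_∈? K) T ⟩
    length (filter (_∈? K) (concat T))                       ≤⟨ unique⊆⇒length≤ (Unique.filter⁺ (_∈? K) (entries-unique tab))
                                                                                 (all-filter (_∈? K) (concat T)) ⟩
    3                                                        ∎
    where open ≤-Reasoning

  rows-of-length-2-and-3 : ∀ T → IsPTableau n d T →
    (3 ∈ shape T → multiplicity 3 (shape T) ≤ 1 × multiplicity 2 (shape T) ≤ 1)
    × (All (_≤ 2) (shape T) → multiplicity 2 (shape T) ≤ 3)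
  rows-of-length-2-and-3 T tab =
      (λ 3∈shape → m+2n≤3⇒n≤1×m≤1 _ _ (tableau-charge≤3 tab) (∈⇒1≤multiplicity 3∈shape))
    , (λ _ → ≤-trans (m≤m+n _ _) (tableau-charge≤3 tab))

lemma4p2 : (n : ℕ) (d : ℕ → ℕ) → IsDyckPath n d → SpecialForm n d → BounceNumber3 n d →
    -- (a)
    (S₃ n d ≢ n ∷ [] → m₀ n d ≡ 1)
    -- (b)
    × (∀ (a₁₁ a₁₂ a₁₃ a₂₁ a₂₂ : ℕ) (rest : List (List ℕ)) →
        let T = (a₁₁ ∷ a₁₂ ∷ a₁₃ ∷ []) ∷ (a₂₁ ∷ a₂₂ ∷ []) ∷ rest in
        IsPTableau n d T → shape T ≡ shape321 n →
        (a₁₃ ≡ n → (a₁₁ ≡ 1 ⊎ a₁₁ ≡ 2) × (a₂₁ ≡ 1 ⊎ a₂₁ ≡ 2))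
        × (a₁₃ ≢ n → S₁ n d ≡ 1 ∷ [] × a₁₁ ≡ 1 × a₁₂ ≡ 2 × a₂₂ ≡ n))
    -- (c)
    × (∀ (T : List (List ℕ)) → IsPTableau n d T →
        (3 ∈ shape T → multiplicity 3 (shape T) ≤ 1 × multiplicity 2 (shape T) ≤ 1)
        × (All (_≤ 2) (shape T) → multiplicity 2 (shape T) ≤ 3))
lemma4p2 n d dyck special b3 =
    m₀≡1 b3
  , (λ a₁₁ a₁₂ a₁₃ a₂₁ a₂₂ rest tab _ → first-two-rows a₁₁ a₁₂ a₁₃ a₂₁ a₂₂ rest tab)
  , rows-of-length-2-and-3
  where open SpecialDyckPath dyck special
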